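{- For every integer $m\geq 1$, the sequence $\{H_{n,m}\}_{n\geq 1}$ of generalized harmonic numbers $H_{n,m}=\sum_{k=1}^n k^{ -m}$ is ratio log-convex.
   Context: A sequence $(x_n)_{n\ge p}$ of positive reals is log-convex if $x_n^2\le x_{n-1}x_{n+1}$ for all $n\ge p+1$. A sequence $(a_n)_{n\ge p}$ of positive reals is ratio log-convex if $(a_{n+1}/a_n)_{n\ge p}$ is log-convex. -}

module Defs where

open import Data.Nat as ℕ using (ℕ; zero; suc; _^_)
open import Data.Nat.Properties using (m^n≢0)
open import Data.Integer using (+_)
open import Data.Rational using (ℚ; 0ℚ; _+_; _*_; _÷_; _/_; _≤_; Positive; _≟_; ≢-nonZero)
open import Data.Product using (_×_)
open import Relation.Nullary using (yes; no)

H : ℕ → ℕ → ℚ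
H zero    m = 0ℚ
H (suc k) m = H k m + (+ 1 / (suc k ^ m)) {{m^n≢0 (suc k) m}}

-- Division made total (q / 0 := 0); only ever applied to positive divisors below.
_÷'_ : ℚ → ℚ → ℚ
p ÷' q with q ≟ 0ℚ
... | yes _  = 0ℚ
... | no q≢0 = (p ÷ q) {{≢-nonZero q≢0}}

-- (x_n)_{n ≥ p} of positive rationals is log-convex:
-- x_n > 0 for n ≥ p, and x_n^2 ≤ x_{n-1} x_{n+1} for all n ≥ p+1
-- (written with n = suc j, j ≥ p).
LogConvex : (ℕ → ℚ) → ℕ → Set
LogConvex x p =
  (∀ n → p ℕ.≤ n → Positive (x n)) ×
  (∀ j → p ℕ.≤ j → x (suc j) * x (suc j) ≤ x j * x (suc (suc j)))

RatioLogConvex : (ℕ → ℚ) → ℕ → Set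
RatioLogConvex a p =
  (∀ n → p ℕ.≤ n → Positive (a n)) ×
  LogConvex (λ n → a (suc n) ÷' a n) p

-- Write S j for the partial sums H j m and a, b, c for the terms 1/(j+1)^m, 1/(j+2)^m,
-- 1/(j+3)^m, so that S(j+1) = S j + a and so on. After clearing denominators, ratio
-- log-convexity at j is the polynomial inequality S(j+2)^3 S j ≤ S(j+1)^3 S(j+3). Its
-- two sides differ by a polynomial with nonnegative coefficients in S j, b, a - b and
-- a + c - 2b, so it holds as soon as the terms are nonincreasing and convex. Convexity
-- of k ↦ 1/k^m follows from its log-convexity, k^m (k+2)^m ≤ (k+1)^(2m), by AM-GM.
module Submission where

open import Defs
open import Data.Nat using (ℕ; _≤_)

open import Algebra.Properties.CommutativeSemigroup using (interchange)
open import Data.Integer as ℤ using (+_)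
import Data.Integer.Properties as ℤP
open import Data.Nat as ℕ using (zero; suc; _^_)
import Data.Nat.Properties as ℕP
open import Data.Nat.Tactic.RingSolver using (solve-∀)
open import Data.Product using (_,_)
open import Data.Rational as ℚ
  using (ℚ; 0ℚ; 1ℚ; _+_; _*_; _-_; _/_; 1/_; Positive; _≟_)
  renaming (_≤_ to _≤ℚ_)
import Data.Rational.Properties as ℚP
open import Data.Rational.Literals using (fromℤ)
open import Data.Rational.Solver using (module +-*-Solver)
import Data.Rational.Unnormalised as ℚᵘ
import Data.Rational.Unnormalised.Properties as ℚᵘP
open import Data.Sum using (inj₁; inj₂)
open import Relation.Binary.PropositionalEquality
open import Relation.Nullary using (yes; no; contradiction)

open +-*-Solver

^-*-mono-≤ : ∀ {a b c d} n → a ℕ.* b ≤ c ℕ.* d → a ^ n ℕ.* b ^ n ≤ c ^ n ℕ.* d ^ n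
^-*-mono-≤ zero    _     = ℕP.≤-refl
^-*-mono-≤ {a} {b} {c} {d} (suc n) ab≤cd = begin
  (a ℕ.* a ^ n) ℕ.* (b ℕ.* b ^ n) ≡⟨ interchange ℕP.*-commutativeSemigroup a (a ^ n) b (b ^ n) ⟩
  (a ℕ.* b) ℕ.* (a ^ n ℕ.* b ^ n) ≤⟨ ℕP.*-mono-≤ ab≤cd (^-*-mono-≤ n ab≤cd) ⟩
  (c ℕ.* d) ℕ.* (c ^ n ℕ.* d ^ n) ≡⟨ interchange ℕP.*-commutativeSemigroup c d (c ^ n) (d ^ n) ⟩
  (c ℕ.* c ^ n) ℕ.* (d ℕ.* d ^ n) ∎
  where open ℕP.≤-Reasoning

powers-logConvex : ∀ k m → k ^ m ℕ.* suc (suc k) ^ m ≤ suc k ^ m ℕ.* suc k ^ m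
powers-logConvex k m = ^-*-mono-≤ m (ℕP.≤-trans (ℕP.m≤n+m _ 1) (ℕP.≤-reflexive (square k)))
  where
  square : ∀ k → 1 ℕ.+ k ℕ.* (2 ℕ.+ k) ≡ (1 ℕ.+ k) ℕ.* (1 ℕ.+ k)
  square = solve-∀

fromℕ : ℕ → ℚ
fromℕ n = fromℤ (+ n)

fromℕ-* : ∀ m n → fromℕ (m ℕ.* n) ≡ fromℕ m * fromℕ n
fromℕ-* m n = ℚP.toℚᵘ-injective
  (ℚᵘP.≃-trans (ℚᵘ.*≡* mn≡m*n) (ℚᵘP.≃-sym (ℚP.toℚᵘ-homo-* (fromℕ m) (fromℕ n))))
  where
  open ≡-Reasoning
  mn≡m*n : + (m ℕ.* n) ℤ.* + 1 ≡ (+ m ℤ.* + n) ℤ.* + 1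
  mn≡m*n = begin
    + (m ℕ.* n) ℤ.* + 1    ≡⟨ ℤP.*-identityʳ _ ⟩
    + (m ℕ.* n)            ≡⟨ ℤP.pos-* m n ⟩
    + m ℤ.* + n            ≡⟨ ℤP.*-identityʳ _ ⟨
    (+ m ℤ.* + n) ℤ.* + 1  ∎

fromℕ-mono-≤ : ∀ {m n} → m ≤ n → fromℕ m ≤ℚ fromℕ n
fromℕ-mono-≤ {m} {n} m≤n =
  ℚ.*≤* (subst₂ ℤ._≤_ (sym (ℤP.*-identityʳ (+ m))) (sym (ℤP.*-identityʳ (+ n))) (ℤ.+≤+ m≤n))

fromℕ-*-1/ : ∀ n .{{_ : ℕ.NonZero n}} → fromℕ n * (+ 1 / n) ≡ 1ℚ
fromℕ-*-1/ (suc k) = trans (cong (fromℕ (suc k) *_) 1/-as-reciprocal) (ℚP.*-inverseʳ (fromℕ (suc k)))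
  where
  1/-as-reciprocal : + 1 / suc k ≡ 1/ fromℕ (suc k)
  1/-as-reciprocal = ℚP.toℚᵘ-injective (ℚP.toℚᵘ-fromℚᵘ (ℚᵘ.mkℚᵘ (+ 1) k))

+-nonNeg : ∀ {p q} → 0ℚ ≤ℚ p → 0ℚ ≤ℚ q → 0ℚ ≤ℚ p + q
+-nonNeg 0≤p 0≤q = ℚP.+-mono-≤ 0≤p 0≤q

*-nonNeg : ∀ {p q} → 0ℚ ≤ℚ p → 0ℚ ≤ℚ q → 0ℚ ≤ℚ p * q
*-nonNeg {p} {q} 0≤p 0≤q = ℚP.nonNegative⁻¹ (p * q)
  {{ℚP.nonNeg*nonNeg⇒nonNeg p {{ℚ.nonNegative 0≤p}} q {{ℚ.nonNegative 0≤q}}}}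

p≤p+q : ∀ p {q} → 0ℚ ≤ℚ q → p ≤ℚ p + q
p≤p+q p 0≤q = subst (_≤ℚ p + _) (ℚP.+-identityʳ p) (ℚP.+-monoʳ-≤ p 0≤q)

p≤q⇒0≤q-p : ∀ {p q} → p ≤ℚ q → 0ℚ ≤ℚ q - p
p≤q⇒0≤q-p {p} {q} p≤q = subst (_≤ℚ q - p) (ℚP.+-inverseʳ p) (ℚP.+-monoˡ-≤ (ℚ.- p) p≤q)

square-nonNeg : ∀ p → 0ℚ ≤ℚ p * p
square-nonNeg p with ℚP.≤-total 0ℚ p
... | inj₁ 0≤p = *-nonNeg 0≤p 0≤p
... | inj₂ p≤0 = ℚP.nonNegative⁻¹ (p * p)
  {{ℚP.nonPos*nonPos⇒nonPos p {{ℚ.nonPositive p≤0}} p {{ℚ.nonPositive p≤0}}}}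

square-cancel-≤ : ∀ {p q} → 0ℚ ≤ℚ q → p * p ≤ℚ q * q → p ≤ℚ q
square-cancel-≤ {p} {q} 0≤q pp≤qq with p ℚP.≤? q
... | yes p≤q = p≤q
... | no  p≰q = contradiction (ℚP.<-≤-trans qq<pp pp≤qq) (ℚP.<-irrefl refl)
  where
  q<p = ℚP.≰⇒> p≰q
  instance
    _ : Positive p
    _ = ℚ.positive (ℚP.≤-<-trans 0≤q q<p)
    _ : ℚ.NonNegative q
    _ = ℚ.nonNegative 0≤q
  qq<pp : q * q ℚ.< p * p
  qq<pp = ℚP.≤-<-trans (ℚP.*-monoˡ-≤-nonNeg q (ℚP.<⇒≤ q<p)) (ℚP.*-monoˡ-<-pos p q<p)

q*q≤p*r⇒q+q≤p+r : ∀ p q r → 0ℚ ≤ℚ p → 0ℚ ≤ℚ r → q * q ≤ℚ p * r → q + q ≤ℚ p + r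
q*q≤p*r⇒q+q≤p+r p q r 0≤p 0≤r qq≤pr = square-cancel-≤ (+-nonNeg 0≤p 0≤r) (begin
  (q + q) * (q + q)                            ≡⟨ solve 1 (λ q → (q :+ q) :* (q :+ q) :=
                                                    (q :* q :+ q :* q) :+ (q :* q :+ q :* q)) refl q ⟩
  (q * q + q * q) + (q * q + q * q)            ≤⟨ ℚP.+-mono-≤ double double ⟩
  (p * r + p * r) + (p * r + p * r)            ≤⟨ p≤p+q _ (square-nonNeg (p - r)) ⟩
  (p * r + p * r) + (p * r + p * r) + (p - r) * (p - r)
                                               ≡⟨ solve 2 (λ p r → (p :* r :+ p :* r) :+ (p :* r :+ p :* r)
                                                      :+ (p :- r) :* (p :- r) := (p :+ r) :* (p :+ r)) refl p r ⟩
  (p + r) * (p + r)                            ∎)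
  where
  open ℚP.≤-Reasoning
  double : q * q + q * q ≤ℚ p * r + p * r
  double = ℚP.+-mono-≤ qq≤pr qq≤pr

*-inverse-* : ∀ x y p q → x * p ≡ 1ℚ → y * q ≡ 1ℚ → (x * y) * (p * q) ≡ 1ℚ
*-inverse-* x y p q xp≡1 yq≡1 = begin
  (x * y) * (p * q)  ≡⟨ solve 4 (λ x y p q → (x :* y) :* (p :* q) := (x :* p) :* (y :* q)) refl x y p q ⟩
  (x * p) * (y * q)  ≡⟨ cong₂ _*_ xp≡1 yq≡1 ⟩
  1ℚ * 1ℚ            ≡⟨ ℚP.*-identityˡ 1ℚ ⟩
  1ℚ                 ∎
  where open ≡-Reasoning

inverse-antimono-≤ : ∀ x y p q → x * p ≡ 1ℚ → y * q ≡ 1ℚ →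
                     0ℚ ≤ℚ p → 0ℚ ≤ℚ q → x ≤ℚ y → q ≤ℚ p
inverse-antimono-≤ x y p q xp≡1 yq≡1 0≤p 0≤q x≤y = begin
  q                ≡⟨ ℚP.*-identityˡ q ⟨
  1ℚ * q           ≡⟨ cong (_* q) xp≡1 ⟨
  x * p * q        ≡⟨ ℚP.*-assoc x p q ⟩
  x * (p * q)      ≤⟨ ℚP.*-monoʳ-≤-nonNeg (p * q) {{ℚ.nonNegative (*-nonNeg 0≤p 0≤q)}} x≤y ⟩
  y * (p * q)      ≡⟨ solve 3 (λ y p q → y :* (p :* q) := y :* q :* p) refl y p q ⟩
  y * q * p        ≡⟨ cong (_* p) yq≡1 ⟩
  1ℚ * p           ≡⟨ ℚP.*-identityˡ p ⟩
  p                ∎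
  where open ℚP.≤-Reasoning

÷'-*-cancel : ∀ p q → Positive q → (p ÷' q) * q ≡ p
÷'-*-cancel p q q>0 with q ≟ 0ℚ
... | yes refl = contradiction (ℚP.positive⁻¹ 0ℚ {{q>0}}) (ℚP.<-irrefl refl)
... | no  q≢0  = begin
  p * (1/ q) * q   ≡⟨ ℚP.*-assoc p (1/ q) q ⟩
  p * (1/ q * q)   ≡⟨ cong (p *_) (ℚP.*-inverseˡ q) ⟩
  p * 1ℚ           ≡⟨ ℚP.*-identityʳ p ⟩
  p                ∎
  where
  open ≡-Reasoning
  instance _ = ℚ.≢-nonZero q≢0

÷'-pos : ∀ p q → Positive p → Positive q → Positive (p ÷' q)
÷'-pos p q p>0 q>0 with q ≟ 0ℚ
... | yes refl = contradiction (ℚP.positive⁻¹ 0ℚ {{q>0}}) (ℚP.<-irrefl refl)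
... | no  q≢0  = ℚP.pos*pos⇒pos p {{p>0}} ((1/ q) {{ℚ.≢-nonZero q≢0}}) {{ℚP.1/pos⇒pos q {{q>0}}}}

cube-≤⇒ratio-square-≤ : ∀ w x y z → Positive w → Positive x → Positive y →
                        y * y * y * w ≤ℚ x * x * x * z →
                        (y ÷' x) * (y ÷' x) ≤ℚ (x ÷' w) * (z ÷' y)
cube-≤⇒ratio-square-≤ w x y z w>0 x>0 y>0 cubes =
  ℚP.*-cancelʳ-≤-pos (x * x * (w * y)) {{xxwy>0}} (subst₂ _≤ℚ_ (sym lhs) (sym rhs) cubes)
  where
  open ≡-Reasoning
  r = y ÷' x
  s = x ÷' w
  t = z ÷' y
  xxwy>0 : Positive (x * x * (w * y))
  xxwy>0 = ℚP.pos*pos⇒pos (x * x) {{ℚP.pos*pos⇒pos x {{x>0}} x {{x>0}}}}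
                          (w * y) {{ℚP.pos*pos⇒pos w {{w>0}} y {{y>0}}}}
  lhs : r * r * (x * x * (w * y)) ≡ y * y * y * w
  lhs = begin
    r * r * (x * x * (w * y))  ≡⟨ solve 4 (λ r x w y → r :* r :* (x :* x :* (w :* y)) :=
                                    (r :* x) :* (r :* x) :* (y :* w)) refl r x w y ⟩
    (r * x) * (r * x) * (y * w) ≡⟨ cong (λ v → v * v * (y * w)) (÷'-*-cancel y x x>0) ⟩
    y * y * (y * w)            ≡⟨ ℚP.*-assoc (y * y) y w ⟨
    y * y * y * w              ∎
  rhs : s * t * (x * x * (w * y)) ≡ x * x * x * z
  rhs = begin
    s * t * (x * x * (w * y))  ≡⟨ solve 5 (λ s t x w y → s :* t :* (x :* x :* (w :* y)) :=
                                    x :* x :* (s :* w) :* (t :* y)) refl s t x w y ⟩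
    x * x * (s * w) * (t * y)  ≡⟨ cong₂ (λ u v → x * x * u * v)
                                      (÷'-*-cancel x w w>0) (÷'-*-cancel z y y>0) ⟩
    x * x * x * z              ∎

cube-≤⇒ratioLogConvex : ∀ a p → (∀ n → p ≤ n → Positive (a n)) →
  (∀ j → p ≤ j → a (2 ℕ.+ j) * a (2 ℕ.+ j) * a (2 ℕ.+ j) * a j ≤ℚ
                 a (1 ℕ.+ j) * a (1 ℕ.+ j) * a (1 ℕ.+ j) * a (3 ℕ.+ j)) →
  RatioLogConvex a p
cube-≤⇒ratioLogConvex a p a>0 cubes =
  a>0 ,
  (λ n p≤n → ÷'-pos (a (suc n)) (a n) (a>0 (suc n) (ℕP.m≤n⇒m≤1+n p≤n)) (a>0 n p≤n)) ,
  (λ j p≤j → cube-≤⇒ratio-square-≤ (a j) (a (1 ℕ.+ j)) (a (2 ℕ.+ j)) (a (3 ℕ.+ j))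
               (a>0 j p≤j) (a>0 (1 ℕ.+ j) (ℕP.m≤n⇒m≤1+n p≤j))
               (a>0 (2 ℕ.+ j) (ℕP.m≤n⇒m≤o+n 2 p≤j))
               (cubes j p≤j))

convex-increments-cube-≤ : ∀ w a b c → 0ℚ ≤ℚ w → 0ℚ ≤ℚ b → b ≤ℚ a → b + b ≤ℚ a + c →
  (w + a + b) * (w + a + b) * (w + a + b) * w ≤ℚ (w + a) * (w + a) * (w + a) * (w + a + b + c)
convex-increments-cube-≤ w a b c 0≤w 0≤b b≤a 2b≤a+c =
  subst (_ ≤ℚ_) (sym expand) (p≤p+q _ 0≤excess)
  where
  x = w + a
  d = a - b
  e = (a + c) - (b + b)
  excess = x * x * x * e + (x * x * b * d + x * x * b * d + x * x * b * d)
         + x * b * b * (a + a + d) + a * b * b * b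
  0≤a = ℚP.≤-trans 0≤b b≤a
  0≤x = +-nonNeg 0≤w 0≤a
  0≤d = p≤q⇒0≤q-p b≤a
  0≤e = p≤q⇒0≤q-p 2b≤a+c
  0≤xxbd = *-nonNeg (*-nonNeg (*-nonNeg 0≤x 0≤x) 0≤b) 0≤d
  0≤excess : 0ℚ ≤ℚ excess
  0≤excess = +-nonNeg (+-nonNeg (+-nonNeg
    (*-nonNeg (*-nonNeg (*-nonNeg 0≤x 0≤x) 0≤x) 0≤e)
    (+-nonNeg (+-nonNeg 0≤xxbd 0≤xxbd) 0≤xxbd))
    (*-nonNeg (*-nonNeg (*-nonNeg 0≤x 0≤b) 0≤b) (+-nonNeg (+-nonNeg 0≤a 0≤a) 0≤d)))
    (*-nonNeg (*-nonNeg (*-nonNeg 0≤a 0≤b) 0≤b) 0≤b)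
  expand : (w + a) * (w + a) * (w + a) * (w + a + b + c) ≡
           (w + a + b) * (w + a + b) * (w + a + b) * w + excess
  expand = solve 4 (λ w a b c → let x = w :+ a ; d = a :- b ; e = (a :+ c) :- (b :+ b) in
     x :* x :* x :* (w :+ a :+ b :+ c) :=
     (w :+ a :+ b) :* (w :+ a :+ b) :* (w :+ a :+ b) :* w :+
     (x :* x :* x :* e :+ (x :* x :* b :* d :+ x :* x :* b :* d :+ x :* x :* b :* d)
      :+ x :* b :* b :* (a :+ a :+ d) :+ a :* b :* b :* b)) refl w a b c

increments-nonNeg : ∀ (S t : ℕ → ℚ) → (∀ n → S (suc n) ≡ S n + t n) →
                    0ℚ ≤ℚ S 0 → (∀ j → 0ℚ ≤ℚ t j) → ∀ n → 0ℚ ≤ℚ S n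
increments-nonNeg S t step 0≤S₀ 0≤t zero    = 0≤S₀
increments-nonNeg S t step 0≤S₀ 0≤t (suc n) =
  subst (0ℚ ≤ℚ_) (sym (step n)) (+-nonNeg (increments-nonNeg S t step 0≤S₀ 0≤t n) (0≤t n))

convex-increments-ratioLogConvex : ∀ (S t : ℕ → ℚ) →
  (∀ n → S (suc n) ≡ S n + t n) → 0ℚ ≤ℚ S 0 →
  (∀ j → Positive (t j)) → (∀ j → t (suc j) ≤ℚ t j) →
  (∀ j → t (1 ℕ.+ j) + t (1 ℕ.+ j) ≤ℚ t j + t (2 ℕ.+ j)) →
  RatioLogConvex S 1
convex-increments-ratioLogConvex S t step 0≤S₀ t>0 antitone convex =
  cube-≤⇒ratioLogConvex S 1 S>0 cubes
  where
  0≤t : ∀ j → 0ℚ ≤ℚ t j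
  0≤t j = ℚP.<⇒≤ (ℚP.positive⁻¹ (t j) {{t>0 j}})
  0≤S : ∀ n → 0ℚ ≤ℚ S n
  0≤S = increments-nonNeg S t step 0≤S₀ 0≤t
  S>0 : ∀ n → 1 ≤ n → Positive (S n)
  S>0 (suc n) _ = subst Positive (sym (step n))
    (ℚP.nonNeg+pos⇒pos (S n) {{ℚ.nonNegative (0≤S n)}} (t n) {{t>0 n}})
  cubes : ∀ j → 1 ≤ j → S (2 ℕ.+ j) * S (2 ℕ.+ j) * S (2 ℕ.+ j) * S j ≤ℚ
                         S (1 ℕ.+ j) * S (1 ℕ.+ j) * S (1 ℕ.+ j) * S (3 ℕ.+ j)
  cubes (suc j) _ rewrite step (3 ℕ.+ j) | step (2 ℕ.+ j) | step (1 ℕ.+ j) =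
    convex-increments-cube-≤ (S (1 ℕ.+ j)) (t (1 ℕ.+ j)) (t (2 ℕ.+ j)) (t (3 ℕ.+ j))
      (0≤S (1 ℕ.+ j)) (0≤t (2 ℕ.+ j)) (antitone (1 ℕ.+ j)) (convex (1 ℕ.+ j))

harmonicTerm : ℕ → ℕ → ℚ
harmonicTerm m j = (+ 1 / suc j ^ m) {{ℕP.m^n≢0 (suc j) m}}

module _ (m : ℕ) where

  harmonicTerm-pos : ∀ j → Positive (harmonicTerm m j)
  harmonicTerm-pos j = ℚP.normalize-pos 1 (suc j ^ m) {{ℕP.m^n≢0 (suc j) m}}

  private
    t = harmonicTerm m

    0≤t : ∀ j → 0ℚ ≤ℚ t j
    0≤t j = ℚP.<⇒≤ (ℚP.positive⁻¹ (t j) {{harmonicTerm-pos j}})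

    n = λ j → fromℕ (suc j ^ m)

    n*t≡1 : ∀ j → n j * t j ≡ 1ℚ
    n*t≡1 j = fromℕ-*-1/ (suc j ^ m) {{ℕP.m^n≢0 (suc j) m}}

  harmonicTerm-antitone : ∀ j → harmonicTerm m (suc j) ≤ℚ harmonicTerm m j
  harmonicTerm-antitone j = inverse-antimono-≤ (n j) (n (1 ℕ.+ j)) (t j) (t (1 ℕ.+ j))
    (n*t≡1 j) (n*t≡1 (1 ℕ.+ j)) (0≤t j) (0≤t (1 ℕ.+ j))
    (fromℕ-mono-≤ (ℕP.^-monoˡ-≤ m (ℕP.n≤1+n (suc j))))

  harmonicTerm-logConvex : ∀ j → harmonicTerm m (1 ℕ.+ j) * harmonicTerm m (1 ℕ.+ j) ≤ℚ
                                 harmonicTerm m j * harmonicTerm m (2 ℕ.+ j)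
  harmonicTerm-logConvex j = inverse-antimono-≤ (n j * n (2 ℕ.+ j)) (n (1 ℕ.+ j) * n (1 ℕ.+ j))
    (t j * t (2 ℕ.+ j)) (t (1 ℕ.+ j) * t (1 ℕ.+ j))
    (*-inverse-* (n j) (n (2 ℕ.+ j)) (t j) (t (2 ℕ.+ j)) (n*t≡1 j) (n*t≡1 (2 ℕ.+ j)))
    (*-inverse-* (n (1 ℕ.+ j)) (n (1 ℕ.+ j)) (t (1 ℕ.+ j)) (t (1 ℕ.+ j))
                 (n*t≡1 (1 ℕ.+ j)) (n*t≡1 (1 ℕ.+ j)))
    (*-nonNeg (0≤t j) (0≤t (2 ℕ.+ j))) (*-nonNeg (0≤t (1 ℕ.+ j)) (0≤t (1 ℕ.+ j)))
    (subst₂ _≤ℚ_ (fromℕ-* (suc j ^ m) ((3 ℕ.+ j) ^ m)) (fromℕ-* ((2 ℕ.+ j) ^ m) ((2 ℕ.+ j) ^ m))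
      (fromℕ-mono-≤ (powers-logConvex (suc j) m)))

  harmonicTerm-convex : ∀ j → harmonicTerm m (1 ℕ.+ j) + harmonicTerm m (1 ℕ.+ j) ≤ℚ
                              harmonicTerm m j + harmonicTerm m (2 ℕ.+ j)
  harmonicTerm-convex j = q*q≤p*r⇒q+q≤p+r (t j) (t (1 ℕ.+ j)) (t (2 ℕ.+ j))
    (0≤t j) (0≤t (2 ℕ.+ j)) (harmonicTerm-logConvex j)

theorem3p7 : (m : ℕ) → 1 ≤ m → RatioLogConvex (λ n → H n m) 1
theorem3p7 m _ = convex-increments-ratioLogConvex (λ n → H n m) (harmonicTerm m) (λ _ → refl) ℚP.≤-refl
  (harmonicTerm-pos m) (harmonicTerm-antitone m) (harmonicTerm-convex m)
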